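{- Let $\mathcal{E}$ be the labelled calculus with the rules $(id),(\bot_l),(\wedge_l),(\wedge_r),(\vee_l),(\vee_r),(\supset_r),(ref),(tra),(id^*),(\supset^*_l),(lift)$ (i.e. $\mathsf{G3Int}+\{(id^*),(\supset^*_l),(lift)\}$ without $(\supset_l)$). Then the rule $(\supset_l)$ is admissible in $\mathcal{E}$: whenever $\mathcal{R},w\le v,w:A\supset B,\Gamma\Rightarrow\Delta,v:A$ and $\mathcal{R},w\le v,w:A\supset B,v:B,\Gamma\Rightarrow\Delta$ are derivable in $\mathcal{E}$, so is $\mathcal{R},w\le v,w:A\supset B,\Gamma\Rightarrow\Delta$.
   Context: Propositional formulas: $A ::= p \mid \bot \mid (A\vee A)\mid (A\wedge A)\mid (A\supset A)$. Labelled sequents $\mathcal{R},\Gamma\Rightarrow\Delta$: $\mathcal{R}$ a multiset of relational atoms $w\le v$, $\Gamma,\Delta$ multisets of labelled formulas $w:A$; components may be empty. Rules: $(id)$: $\mathcal{R},w\le v,w:p,\Gamma\Rightarrow\Delta,v:p$; $(\bot_l)$: $\mathcal{R},w:\bot,\Gamma\Rightarrow\Delta$; $(\wedge_l)$: from $\mathcal{R},w:A,w:B,\Gamma\Rightarrow\Delta$ infer $\mathcal{R},w:A\wedge B,\Gamma\Rightarrow\Delta$; $(\wedge_r)$: from $\mathcal{R},\Gamma\Rightarrow\Delta,w:A$ and $\mathcal{R},\Gamma\Rightarrow\Delta,w:B$ infer $\mathcal{R},\Gamma\Rightarrow\Delta,w:A\wedge B$; $(\vee_l)$: from $\mathcal{R},w:A,\Gamma\Rightarrow\Delta$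 and $\mathcal{R},w:B,\Gamma\Rightarrow\Delta$ infer $\mathcal{R},w:A\vee B,\Gamma\Rightarrow\Delta$; $(\vee_r)$: from $\mathcal{R},\Gamma\Rightarrow\Delta,w:A,w:B$ infer $\mathcal{R},\Gamma\Rightarrow\Delta,w:A\vee B$; $(\supset_r)$: from $\mathcal{R},w\le v,v:A,\Gamma\Rightarrow\Delta,v:B$ infer $\mathcal{R},\Gamma\Rightarrow\Delta,w:A\supset B$, provided $v$ does not occur in the conclusion; $(ref)$: from $\mathcal{R},w\le w,\Gamma\Rightarrow\Delta$ infer $\mathcal{R},\Gamma\Rightarrow\Delta$; $(tra)$: from $\mathcal{R},w\le v,v\le u,w\le u,\Gamma\Rightarrow\Delta$ infer $\mathcal{R},w\le v,v\le u,\Gamma\Rightarrow\Delta$; $(id^*)$: $\mathcal{R},w:p,\Gamma\Rightarrow\Delta,w:p$; $(\supset^*_l)$: from $\mathcal{R},w:A\supset B,\Gamma\Rightarrow\Delta,w:A$ and $\mathcal{R},w:A\supset B,w:B,\Gamma\Rightarrow\Delta$ infer $\mathcal{R},w:A\supset B,\Gamma\Rightarrow\Delta$; $(lift)$: from $\mathcal{R},w\le u,w:A,u:A,\Gamma\Rightarrow\Delta$ infer $\mathcal{R},w\le u,w:A,\Gamma\Rightarrow\Delta$. -}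

module Defs where

open import Data.Nat using (ℕ)
open import Data.Product using (_×_; _,_)
open import Data.List using (List; []; _∷_)
open import Data.List.Relation.Unary.Any using (Any)
open import Data.List.Relation.Binary.Permutation.Propositional using (_↭_)
open import Relation.Binary.PropositionalEquality using (_≡_)
open import Relation.Nullary using (¬_)
open import Data.Sum using (_⊎_)

Var : Set
Var = ℕ

Label : Set
Label = ℕ

data Formula : Set where
  atom : Var → Formula
  ⊥'   : Formula
  _∨'_ : Formula → Formula → Formula
  _∧'_ : Formula → Formula → Formula
  _⊃_  : Formula → Formula → Formula

record RelAtom : Set where
  constructor _≤ᵣ_
  field
    src : Label
    tgt : Label

record LForm : Set where
  constructor _∶_
  field
    lab : Label
    frm : Formula

-- Multisets are represented as lists; derivability is closed under
-- permutation of each component (rule `perm` below), so lists behave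
-- exactly as multisets.
Rel : Set
Rel = List RelAtom

Ctx : Set
Ctx = List LForm

_occR_ : Label → Rel → Set
v occR R = Any (λ a → RelAtom.src a ≡ v ⊎ RelAtom.tgt a ≡ v) R

_occC_ : Label → Ctx → Set
v occC Γ = Any (λ x → LForm.lab x ≡ v) Γ

infix 3 E⊢_∣_⇒_
data E⊢_∣_⇒_ : Rel → Ctx → Ctx → Set where
  perm : ∀ {R R' Γ Γ' Δ Δ'} → R ↭ R' → Γ ↭ Γ' → Δ ↭ Δ' →
         E⊢ R ∣ Γ ⇒ Δ → E⊢ R' ∣ Γ' ⇒ Δ'
  id   : ∀ {R Γ Δ w v p} →
         E⊢ (w ≤ᵣ v) ∷ R ∣ (w ∶ atom p) ∷ Γ ⇒ (v ∶ atom p) ∷ Δ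
  ⊥l   : ∀ {R Γ Δ w} → E⊢ R ∣ (w ∶ ⊥') ∷ Γ ⇒ Δ
  ∧l   : ∀ {R Γ Δ w A B} →
         E⊢ R ∣ (w ∶ A) ∷ (w ∶ B) ∷ Γ ⇒ Δ →
         E⊢ R ∣ (w ∶ (A ∧' B)) ∷ Γ ⇒ Δ
  ∧r   : ∀ {R Γ Δ w A B} →
         E⊢ R ∣ Γ ⇒ (w ∶ A) ∷ Δ → E⊢ R ∣ Γ ⇒ (w ∶ B) ∷ Δ →
         E⊢ R ∣ Γ ⇒ (w ∶ (A ∧' B)) ∷ Δ
  ∨l   : ∀ {R Γ Δ w A B} →
         E⊢ R ∣ (w ∶ A) ∷ Γ ⇒ Δ → E⊢ R ∣ (w ∶ B) ∷ Γ ⇒ Δ →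
         E⊢ R ∣ (w ∶ (A ∨' B)) ∷ Γ ⇒ Δ
  ∨r   : ∀ {R Γ Δ w A B} →
         E⊢ R ∣ Γ ⇒ (w ∶ A) ∷ (w ∶ B) ∷ Δ →
         E⊢ R ∣ Γ ⇒ (w ∶ (A ∨' B)) ∷ Δ
  ⊃r   : ∀ {R Γ Δ w v A B} →
         ¬ (v ≡ w) → ¬ (v occR R) → ¬ (v occC Γ) → ¬ (v occC Δ) →
         E⊢ (w ≤ᵣ v) ∷ R ∣ (v ∶ A) ∷ Γ ⇒ (v ∶ B) ∷ Δ →
         E⊢ R ∣ Γ ⇒ (w ∶ (A ⊃ B)) ∷ Δ
  ref  : ∀ {R Γ Δ w} →
         E⊢ (w ≤ᵣ w) ∷ R ∣ Γ ⇒ Δ → E⊢ R ∣ Γ ⇒ Δ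
  tra  : ∀ {R Γ Δ w v u} →
         E⊢ (w ≤ᵣ v) ∷ (v ≤ᵣ u) ∷ (w ≤ᵣ u) ∷ R ∣ Γ ⇒ Δ →
         E⊢ (w ≤ᵣ v) ∷ (v ≤ᵣ u) ∷ R ∣ Γ ⇒ Δ
  id*  : ∀ {R Γ Δ w p} →
         E⊢ R ∣ (w ∶ atom p) ∷ Γ ⇒ (w ∶ atom p) ∷ Δ
  ⊃*l  : ∀ {R Γ Δ w A B} →
         E⊢ R ∣ (w ∶ (A ⊃ B)) ∷ Γ ⇒ (w ∶ A) ∷ Δ →
         E⊢ R ∣ (w ∶ (A ⊃ B)) ∷ (w ∶ B) ∷ Γ ⇒ Δ →
         E⊢ R ∣ (w ∶ (A ⊃ B)) ∷ Γ ⇒ Δ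
  lift : ∀ {R Γ Δ w u A} →
         E⊢ (w ≤ᵣ u) ∷ R ∣ (w ∶ A) ∷ (u ∶ A) ∷ Γ ⇒ Δ →
         E⊢ (w ≤ᵣ u) ∷ R ∣ (w ∶ A) ∷ Γ ⇒ Δ

-- (⊃l) at w ≤ v is simulated by (lift), which copies w : A ⊃ B to v, followed by (⊃*l) at v.
-- The two premises of (⊃*l) are the given premises with v : A ⊃ B added on the left, so
-- everything rests on admissibility of left weakening. Weakening must rename the eigenvariable
-- of a (⊃r) step that would clash with the added formula; hence it is proved simultaneously
-- for all injective relabellings of the derivation, the eigenvariable being moved to a fresh
-- label by a transposition.
module Submission where

open import Defs
open import Data.List using ([]; _∷_; map)
open import Data.List.Properties using (map-id; map-cong-local)
open import Data.List.Relation.Unary.Any using (here; there)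
open import Data.List.Relation.Unary.Any.Properties using (map⁺)
import Data.List.Relation.Unary.All as All
open import Data.List.Relation.Unary.All.Properties using (¬Any⇒All¬)
open import Data.List.Relation.Binary.Permutation.Propositional using (refl; prep; swap; trans)
import Data.List.Relation.Binary.Permutation.Propositional.Properties as ↭
open import Data.Nat using (ℕ; suc; _≤_; s≤s; _⊔_; _≟_)
open import Data.Nat.Properties using (m≤m⊔n; m≤n⊔m; m≤n⇒m≤n⊔o; m≤n⇒m≤o⊔n; 1+n≰n; >⇒≢)
open import Data.Product using (_×_; _,_)
open import Data.Sum using (_⊎_; inj₁; inj₂)
open import Function using (_∘_)
open import Function.Definitions using (Injective)
open import Relation.Binary.PropositionalEquality using (_≡_; _≢_; refl; sym; cong; cong₂)
import Relation.Binary.PropositionalEquality as ≡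
open import Relation.Nullary using (¬_; yes; no; contradiction)

private
  variable
    R R' : Rel
    Γ Γ' Δ Δ' : Ctx
    x y z : LForm
    σ : Label → Label
    u v : Label

cast : R ≡ R' → Γ ≡ Γ' → Δ ≡ Δ' → E⊢ R ∣ Γ ⇒ Δ → E⊢ R' ∣ Γ' ⇒ Δ'
cast refl refl refl d = d

exchange : E⊢ R ∣ x ∷ y ∷ Γ ⇒ Δ → E⊢ R ∣ y ∷ x ∷ Γ ⇒ Δ
exchange = perm refl (swap _ _ refl) refl

rotate : E⊢ R ∣ x ∷ y ∷ z ∷ Γ ⇒ Δ → E⊢ R ∣ y ∷ z ∷ x ∷ Γ ⇒ Δ
rotate = perm refl (trans (swap _ _ refl) (prep _ (swap _ _ refl))) refl

renameRel : (Label → Label) → Rel → Rel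
renameRel σ = map λ (w ≤ᵣ v) → σ w ≤ᵣ σ v

renameCtx : (Label → Label) → Ctx → Ctx
renameCtx σ = map λ (w ∶ A) → σ w ∶ A

transpose : Label → Label → Label → Label
transpose a b u with u ≟ a | u ≟ b
... | yes _ | _     = b
... | no _  | yes _ = a
... | no _  | no _  = u

transpose-sends : ∀ a b → transpose a b a ≡ b
transpose-sends a b with a ≟ a
... | yes _   = refl
... | no a≢a = contradiction refl a≢a

transpose-sends⁻¹ : ∀ a b → transpose a b b ≡ a
transpose-sends⁻¹ a b with b ≟ a | b ≟ b
... | yes b≡a | _       = b≡a
... | no _    | yes _   = refl
... | no _    | no b≢b = contradiction refl b≢b

transpose-fixes : ∀ {a b} → u ≢ a → u ≢ b → transpose a b u ≡ u
transpose-fixes {u} {a} {b} u≢a u≢b with u ≟ a | u ≟ b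
... | yes u≡a | _       = contradiction u≡a u≢a
... | no _    | yes u≡b = contradiction u≡b u≢b
... | no _    | no _    = refl

transpose-involutive : ∀ a b u → transpose a b (transpose a b u) ≡ u
transpose-involutive a b u with u ≟ a | u ≟ b
... | yes refl | _        = transpose-sends⁻¹ u b
... | no _     | yes refl = transpose-sends a u
... | no u≢a   | no u≢b   = transpose-fixes u≢a u≢b

transpose-injective : ∀ a b → Injective _≡_ _≡_ (transpose a b)
transpose-injective a b {u} {u'} eq = begin
  u                                 ≡⟨ sym (transpose-involutive a b u) ⟩
  transpose a b (transpose a b u)   ≡⟨ cong (transpose a b) eq ⟩
  transpose a b (transpose a b u')  ≡⟨ transpose-involutive a b u' ⟩
  u'                                ∎
  where open ≡.≡-Reasoning

module _ (σ-inj : Injective _≡_ _≡_ σ) (v b : Label) where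

  transpose-after-fixes : u ≢ v → σ u ≢ b → transpose (σ v) b (σ u) ≡ σ u
  transpose-after-fixes u≢v σu≢b = transpose-fixes (u≢v ∘ σ-inj) σu≢b

  renameRel-transpose : ¬ v occR R → ¬ b occR renameRel σ R →
                        renameRel (transpose (σ v) b ∘ σ) R ≡ renameRel σ R
  renameRel-transpose {R} v∉R b∉σR =
    map-cong-local (All.zipWith fixes (¬Any⇒All¬ R v∉R , ¬Any⇒All¬ R (b∉σR ∘ map⁺)))
    where
    fixes : ∀ {s t} → ¬ (s ≡ v ⊎ t ≡ v) × ¬ (σ s ≡ b ⊎ σ t ≡ b) →
            (transpose (σ v) b (σ s) ≤ᵣ transpose (σ v) b (σ t)) ≡ (σ s ≤ᵣ σ t)
    fixes (v∉st , b∉σst) = cong₂ _≤ᵣ_ (transpose-after-fixes (v∉st ∘ inj₁) (b∉σst ∘ inj₁))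
                                      (transpose-after-fixes (v∉st ∘ inj₂) (b∉σst ∘ inj₂))

  renameCtx-transpose : ¬ v occC Γ → ¬ b occC renameCtx σ Γ →
                        renameCtx (transpose (σ v) b ∘ σ) Γ ≡ renameCtx σ Γ
  renameCtx-transpose {Γ} v∉Γ b∉σΓ =
    map-cong-local (All.zipWith (λ (v∉x , b∉σx) → cong (_∶ _) (transpose-after-fixes v∉x b∉σx))
                                (¬Any⇒All¬ Γ v∉Γ , ¬Any⇒All¬ Γ (b∉σΓ ∘ map⁺)))

supRel : Rel → ℕ
supRel []             = 0
supRel ((s ≤ᵣ t) ∷ R) = s ⊔ t ⊔ supRel R

supCtx : Ctx → ℕ
supCtx []           = 0
supCtx ((s ∶ _) ∷ Γ) = s ⊔ supCtx Γ

occR⇒≤supRel : v occR R → v ≤ supRel R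
occR⇒≤supRel {R = (s ≤ᵣ t) ∷ R} (here (inj₁ refl)) = m≤n⇒m≤n⊔o (supRel R) (m≤m⊔n s t)
occR⇒≤supRel {R = (s ≤ᵣ t) ∷ R} (here (inj₂ refl)) = m≤n⇒m≤n⊔o (supRel R) (m≤n⊔m s t)
occR⇒≤supRel {R = (s ≤ᵣ t) ∷ R} (there v∈R)       = m≤n⇒m≤o⊔n (s ⊔ t) (occR⇒≤supRel v∈R)

occC⇒≤supCtx : v occC Γ → v ≤ supCtx Γ
occC⇒≤supCtx {Γ = (s ∶ _) ∷ Γ} (here refl)  = m≤m⊔n s (supCtx Γ)
occC⇒≤supCtx {Γ = (s ∶ _) ∷ Γ} (there v∈Γ) = m≤n⇒m≤o⊔n s (occC⇒≤supCtx v∈Γ)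

record FreshFor (v w : Label) (R : Rel) (Γ Δ : Ctx) : Set where
  field
    ≢w : v ≢ w
    ∉R : ¬ v occR R
    ∉Γ : ¬ v occC Γ
    ∉Δ : ¬ v occC Δ

freshLabel : Label → Rel → Ctx → Ctx → Label
freshLabel w R Γ Δ = suc (w ⊔ supRel R ⊔ supCtx Γ ⊔ supCtx Δ)

freshLabel-fresh : ∀ w R Γ Δ → FreshFor (freshLabel w R Γ Δ) w R Γ Δ
freshLabel-fresh w R Γ Δ = record
  { ≢w = >⇒≢ (s≤s (m≤n⇒m≤n⊔o (supCtx Δ) (m≤n⇒m≤n⊔o (supCtx Γ) (m≤m⊔n w (supRel R)))))
  ; ∉R = λ v∈R → 1+n≰n
      (m≤n⇒m≤n⊔o (supCtx Δ) (m≤n⇒m≤n⊔o (supCtx Γ) (m≤n⇒m≤o⊔n w (occR⇒≤supRel v∈R))))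
  ; ∉Γ = λ v∈Γ → 1+n≰n (m≤n⇒m≤n⊔o (supCtx Δ) (m≤n⇒m≤o⊔n (w ⊔ supRel R) (occC⇒≤supCtx v∈Γ)))
  ; ∉Δ = λ v∈Δ → 1+n≰n (m≤n⇒m≤o⊔n (w ⊔ supRel R ⊔ supCtx Γ) (occC⇒≤supCtx v∈Δ))
  }

weakenˡ-rename : Injective _≡_ _≡_ σ → ∀ x → E⊢ R ∣ Γ ⇒ Δ →
                 E⊢ renameRel σ R ∣ x ∷ renameCtx σ Γ ⇒ renameCtx σ Δ
weakenˡ-rename σ-inj x (perm R↭R' Γ↭Γ' Δ↭Δ' d) =
  perm (↭.map⁺ _ R↭R') (prep x (↭.map⁺ _ Γ↭Γ')) (↭.map⁺ _ Δ↭Δ') (weakenˡ-rename σ-inj x d)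
weakenˡ-rename σ-inj x id         = exchange id
weakenˡ-rename σ-inj x ⊥l         = exchange ⊥l
weakenˡ-rename σ-inj x id*        = exchange id*
weakenˡ-rename σ-inj x (∧l d)     = exchange (∧l (rotate (weakenˡ-rename σ-inj x d)))
weakenˡ-rename σ-inj x (∧r d e)   = ∧r (weakenˡ-rename σ-inj x d) (weakenˡ-rename σ-inj x e)
weakenˡ-rename σ-inj x (∨l d e)   =
  exchange (∨l (exchange (weakenˡ-rename σ-inj x d)) (exchange (weakenˡ-rename σ-inj x e)))
weakenˡ-rename σ-inj x (∨r d)     = ∨r (weakenˡ-rename σ-inj x d)
weakenˡ-rename σ-inj x (ref d)    = ref (weakenˡ-rename σ-inj x d)
weakenˡ-rename σ-inj x (tra d)    = tra (weakenˡ-rename σ-inj x d)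
weakenˡ-rename σ-inj x (⊃*l d e)  =
  exchange (⊃*l (exchange (weakenˡ-rename σ-inj x d)) (rotate (weakenˡ-rename σ-inj x e)))
weakenˡ-rename σ-inj x (lift d)   = exchange (lift (rotate (weakenˡ-rename σ-inj x d)))
weakenˡ-rename {σ = σ} σ-inj x (⊃r {R} {Γ} {Δ} {w} {v} {A} {B} v≢w v∉R v∉Γ v∉Δ d) =
  ⊃r ≢w ∉R ∉Γ ∉Δ (exchange (cast τ-on-R τ-on-Γ τ-on-Δ (weakenˡ-rename τ-inj x d)))
  where
  v' = freshLabel (σ w) (renameRel σ R) (x ∷ renameCtx σ Γ) (renameCtx σ Δ)
  open FreshFor (freshLabel-fresh (σ w) (renameRel σ R) (x ∷ renameCtx σ Γ) (renameCtx σ Δ))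

  τ : Label → Label
  τ = transpose (σ v) v' ∘ σ

  τ-inj : Injective _≡_ _≡_ τ
  τ-inj = σ-inj ∘ transpose-injective (σ v) v'

  τ-on-R : renameRel τ ((w ≤ᵣ v) ∷ R) ≡ (σ w ≤ᵣ v') ∷ renameRel σ R
  τ-on-R = cong₂ _∷_
    (cong₂ _≤ᵣ_ (transpose-after-fixes σ-inj v v' (v≢w ∘ sym) (≢w ∘ sym)) (transpose-sends (σ v) v'))
    (renameRel-transpose σ-inj v v' v∉R ∉R)

  τ-on-Γ : x ∷ renameCtx τ ((v ∶ A) ∷ Γ) ≡ x ∷ (v' ∶ A) ∷ renameCtx σ Γ
  τ-on-Γ = cong (x ∷_) (cong₂ _∷_ (cong (_∶ A) (transpose-sends (σ v) v'))
                                  (renameCtx-transpose σ-inj v v' v∉Γ (∉Γ ∘ there)))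

  τ-on-Δ : renameCtx τ ((v ∶ B) ∷ Δ) ≡ (v' ∶ B) ∷ renameCtx σ Δ
  τ-on-Δ = cong₂ _∷_ (cong (_∶ B) (transpose-sends (σ v) v'))
                     (renameCtx-transpose σ-inj v v' v∉Δ ∉Δ)

weakenˡ : ∀ x → E⊢ R ∣ Γ ⇒ Δ → E⊢ R ∣ x ∷ Γ ⇒ Δ
weakenˡ {R} {Γ} {Δ} x d =
  -- renaming by the identity is map id up to record η, so map-id applies
  cast (map-id R) (cong (x ∷_) (map-id Γ)) (map-id Δ) (weakenˡ-rename (λ eq → eq) x d)

lemma4 : ∀ (R : Rel) (Γ Δ : Ctx) (w v : Label) (A B : Formula) →
    E⊢ (w ≤ᵣ v) ∷ R ∣ (w ∶ (A ⊃ B)) ∷ Γ ⇒ (v ∶ A) ∷ Δ →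
    E⊢ (w ≤ᵣ v) ∷ R ∣ (w ∶ (A ⊃ B)) ∷ (v ∶ B) ∷ Γ ⇒ Δ →
    E⊢ (w ≤ᵣ v) ∷ R ∣ (w ∶ (A ⊃ B)) ∷ Γ ⇒ Δ
lemma4 R Γ Δ w v A B ⊢A ⊢B =
  lift (exchange (⊃*l (weakenˡ (v ∶ (A ⊃ B)) ⊢A)
                      (weakenˡ (v ∶ (A ⊃ B)) (exchange ⊢B))))
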